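{- Let $m,n\ge1$, $N=m+n\ge4$, and $\ell\ge0$. The number $\mathsf{T}^{mn}_\ell(001)$ of binary words of length $N$ with $m$ zeros and $n$ ones in which $001$ occurs (cyclically) exactly $\ell$ times is $$\mathsf{T}^{mn}_{\ell}(001)=\frac{N}{n}\sum_{h=1}^{\min(m,n)}c^{m}_{h\ell}\binom{n}{h},$$ and for $\ell\ge1$ this equals $$\frac{N}{n}\binom{n}{\ell}\sum_{h=\ell}^{\min(m-\ell,\,n)}\binom{m-h-1}{\ell-1}\binom{n-\ell}{h-\ell}.$$
   Context: Occurrences are cyclic: for $S=\alpha_1\cdots\alpha_N$ and a word $U$ with $|U|<N$, count the $i\in\{1,\dots,N\}$ with $\alpha_i\cdots\alpha_{i+|U|-1}=U$, indices modulo $N$. The coefficients are $c^{m}_{h\ell}=\frac{\ell}{m-h}\binom{h}{\ell}\binom{m-h}{\ell}$ for $h<m$, $c^m_{m\ell}=1$ if $\ell=0$ and $0$ otherwise. Binomial coefficients $\binom{a}{b}$ are $0$ unless $0\le b\le a$. -}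

module Defs where

open import Data.Bool using (Bool; true; false; _∧_; if_then_else_)
open import Data.Nat using (ℕ; zero; suc; _∸_; _<ᵇ_; _≡ᵇ_)
open import Data.Nat.Combinatorics using (_C_)
open import Data.List using (List; []; _∷_; _++_; map; length; filter; upTo; drop; concatMap)
open import Data.Integer using (+_)
open import Data.Rational using (ℚ; _/_; 0ℚ; 1ℚ; _*_)
import Data.Rational as Q

eqB : Bool → Bool → Bool
eqB true  true  = true
eqB false false = true
eqB _     _     = false

allWords : ℕ → List (List Bool)
allWords zero    = [] ∷ []
allWords (suc k) = concatMap (λ w → (false ∷ w) ∷ (true ∷ w) ∷ []) (allWords k)

countLetter : Bool → List Bool → ℕ
countLetter b []      = 0
countLetter b (x ∷ w) = (if eqB b x then 1 else 0) Data.Nat.+ countLetter b w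

isPrefix : List Bool → List Bool → Bool
isPrefix []      _       = true
isPrefix (u ∷ U) []      = false
isPrefix (u ∷ U) (x ∷ w) = eqB u x ∧ isPrefix U w

-- cyclic occurrences of U in S (intended for |U| < |S|):
-- number of i ∈ {0,…,N-1} with S_i ⋯ S_{i+|U|-1} = U, indices mod N.
-- Reading S cyclically: position i of the cyclic word starts at drop i (S ++ S).
cycOcc : List Bool → List Bool → ℕ
cycOcc U S = length (filter (λ i → isPrefix U (drop i (S ++ S)) Data.Bool.≟ true) (upTo (length S)))

-- the word 001 (0 = false, 1 = true)
w001 : List Bool
w001 = false ∷ false ∷ true ∷ []

T : ℕ → ℕ → ℕ → List Bool → ℕ
T m n ℓ U = length (filter (λ w → ((countLetter false w ≡ᵇ m) ∧ (countLetter true w ≡ᵇ n) ∧ (cycOcc U w ≡ᵇ ℓ)) Data.Bool.≟ true) (allWords (m Data.Nat.+ n)))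

ℕ→ℚ : ℕ → ℚ
ℕ→ℚ k = (+ k) / 1

-- a / d as a rational; convention: value 0 when d = 0 (only used with d ≥ 1)
frac : ℕ → ℕ → ℚ
frac a zero    = 0ℚ
frac a (suc d) = (+ a) / suc d

-- c^m_{hℓ} = ℓ/(m-h) * C(h,ℓ) * C(m-h,ℓ) for h < m; c^m_{mℓ} = [ℓ = 0]
-- (for h > m, not used, we put 0)
c : ℕ → ℕ → ℕ → ℚ
c m h ℓ = if h <ᵇ m then frac ℓ (m ∸ h) * ℕ→ℚ ((h C ℓ) Data.Nat.* ((m ∸ h) C ℓ))
          else (if h ≡ᵇ m then (if ℓ ≡ᵇ 0 then 1ℚ else 0ℚ) else 0ℚ)

sumFromTo : ℕ → ℕ → (ℕ → ℚ) → ℚ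
sumFromTo a b f = Data.List.foldr Q._+_ 0ℚ (map (λ i → f (a Data.Nat.+ i)) (upTo (suc b ∸ a)))

-- Rotation preserves the letter counts and the cyclic occurrences of 001, and every one of
-- the n ones of a word reaches the front in exactly one of its N rotations; double counting
-- gives n·T = N·T₁, where T₁ counts the words of the class that begin with 1. Such a word
-- 1v has as many cyclic occurrences as v1 has linear ones, which an automaton remembering
-- the trailing zeros (none, one, at least two) counts; splitting off the leading block
-- 1, 01 or 0ⁱ1 (i ≥ 2) gives a recurrence in the number of ones whose unique solution is
-- T₁ = C(n,ℓ)·R(n−ℓ,m,ℓ) with R built by Pascal's rule from explicit initial values. For
-- ℓ ≥ 1 this unfolds to C(n,ℓ)·∑ₕ C(m−h−1,ℓ−1)·C(n−ℓ,h−ℓ), the second formula; the first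
-- is the same sum after ℓ/(m−h)·C(m−h,ℓ) = C(m−h−1,ℓ−1) and C(n,h)·C(h,ℓ) = C(n,ℓ)·C(n−ℓ,h−ℓ).

module Submission where

module Counting where
  open import Defs using (T; allWords; countLetter; cycOcc; isPrefix; eqB; w001)
  open import Data.Bool using (Bool; true; false; _∧_; if_then_else_)
  import Data.Bool as Bool
  open import Data.Bool.Properties using (∧-zeroʳ; T-≡)
  open import Data.Unit using (tt)
  open import Data.Nat
  open import Data.Nat.Properties
  open import Data.Nat.Combinatorics using (_C_; nCk+nC[k+1]≡[n+1]C[k+1])
  open import Data.Nat.GeneralisedArithmetic using (iterate)
  open import Data.Nat.Tactic.RingSolver using (solve-∀)
  import Algebra.Properties.CommutativeSemigroup
  open import Data.List using (List; []; _∷_; _++_; length; filter; drop; concatMap; applyUpTo; upTo; _∷ʳ_)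
  open import Data.List.Properties using (++-assoc; ++-identityʳ; length-++)
  open import Data.Product using (_×_; _,_; proj₁)
  open import Function using (_∘_)
  open import Function.Bundles using (Equivalence)
  open import Relation.Binary.PropositionalEquality
  open import Relation.Nullary using (yes; no; does; contradiction)
  open import Relation.Nullary.Decidable using (dec-true; dec-false)
  open import Relation.Nullary.Reflects using (ofʸ; ofⁿ)
  module +-CS = Algebra.Properties.CommutativeSemigroup +-commutativeSemigroup
  module *-CS = Algebra.Properties.CommutativeSemigroup *-commutativeSemigroup
  open ≡-Reasoning

  m∸n<o⇒m<n+o : ∀ m n {o} → m ∸ n < o → m < n + o
  m∸n<o⇒m<n+o m n m∸n<o = ≤-<-trans (m≤n+m∸n m n) (+-monoʳ-< n m∸n<o)

  m≤o∸n⇒m+n≤o′ : ∀ {m n o} → 0 < m → m ≤ o ∸ n → m + n ≤ o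
  m≤o∸n⇒m+n≤o′ {m} {n} {o} 0<m m≤o∸n with n ≤? o
  ... | yes n≤o = m≤o∸n⇒m+n≤o m n≤o m≤o∸n
  ... | no  n≰o = contradiction (≤-trans m≤o∸n (≤-reflexive (m≤n⇒m∸n≡0 (<⇒≤ (≰⇒> n≰o))))) (<⇒≱ 0<m)

  ∑ : ℕ → (ℕ → ℕ) → ℕ
  ∑ zero    f = 0
  ∑ (suc n) f = f 0 + ∑ n (f ∘ suc)

  ∑-cong-< : ∀ n {f g : ℕ → ℕ} → (∀ i → i < n → f i ≡ g i) → ∑ n f ≡ ∑ n g
  ∑-cong-< zero    eq = refl
  ∑-cong-< (suc n) eq = cong₂ _+_ (eq 0 z<s) (∑-cong-< n (λ i i<n → eq (suc i) (s<s i<n)))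

  ∑-cong : ∀ n {f g : ℕ → ℕ} → (∀ i → f i ≡ g i) → ∑ n f ≡ ∑ n g
  ∑-cong n eq = ∑-cong-< n (λ i _ → eq i)

  ∑-zero : ∀ n (f : ℕ → ℕ) → (∀ i → i < n → f i ≡ 0) → ∑ n f ≡ 0
  ∑-zero zero    f eq = refl
  ∑-zero (suc n) f eq = cong₂ _+_ (eq 0 z<s) (∑-zero n (f ∘ suc) (λ i i<n → eq (suc i) (s<s i<n)))

  ∑-const : ∀ n c → ∑ n (λ _ → c) ≡ n * c
  ∑-const zero    c = refl
  ∑-const (suc n) c = cong (c +_) (∑-const n c)

  ∑-+ : ∀ n (f g : ℕ → ℕ) → ∑ n (λ i → f i + g i) ≡ ∑ n f + ∑ n g
  ∑-+ zero    f g = refl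
  ∑-+ (suc n) f g = trans (cong (f 0 + g 0 +_) (∑-+ n (f ∘ suc) (g ∘ suc))) (+-CS.interchange (f 0) (g 0) _ _)

  *-distribˡ-∑ : ∀ n c (f : ℕ → ℕ) → c * ∑ n f ≡ ∑ n (λ i → c * f i)
  *-distribˡ-∑ zero    c f = *-zeroʳ c
  *-distribˡ-∑ (suc n) c f = trans (*-distribˡ-+ c (f 0) _) (cong (c * f 0 +_) (*-distribˡ-∑ n c (f ∘ suc)))

  ∑-split : ∀ a b (f : ℕ → ℕ) → ∑ (a + b) f ≡ ∑ a f + ∑ b (λ i → f (a + i))
  ∑-split zero    b f = refl
  ∑-split (suc a) b f = trans (cong (f 0 +_) (∑-split a b (f ∘ suc))) (sym (+-assoc (f 0) _ _))

  ∑-suc : ∀ n (f : ℕ → ℕ) → ∑ (suc n) f ≡ ∑ n f + f n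
  ∑-suc zero    f = +-comm (f 0) 0
  ∑-suc (suc n) f = trans (cong (f 0 +_) (∑-suc n (f ∘ suc))) (sym (+-assoc (f 0) _ _))

  ∑Range : ℕ → ℕ → (ℕ → ℕ) → ℕ
  ∑Range a b f = ∑ (suc b ∸ a) (λ i → f (a + i))

  restrict : ℕ → ℕ → ℕ → ℕ → ℕ
  restrict a b h x = if does (a ≤? h) ∧ does (h ≤? b) then x else 0

  module _ (a b : ℕ) {h x : ℕ} where

    restrict-in : a ≤ h → h ≤ b → restrict a b h x ≡ x
    restrict-in a≤h h≤b rewrite dec-true (a ≤? h) a≤h | dec-true (h ≤? b) h≤b = refl

    restrict-below : h < a → restrict a b h x ≡ 0
    restrict-below h<a rewrite dec-false (a ≤? h) (<⇒≱ h<a) = refl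

    restrict-above : b < h → restrict a b h x ≡ 0
    restrict-above b<h rewrite dec-false (h ≤? b) (<⇒≱ b<h) | ∧-zeroʳ (does (a ≤? h)) = refl

  restrict-≡0 : ∀ a b h {x} → x ≡ 0 → restrict a b h x ≡ 0
  restrict-≡0 a b h refl with does (a ≤? h) ∧ does (h ≤? b)
  ... | true  = refl
  ... | false = refl

  ∑Range-as-∑ : ∀ a b M (f : ℕ → ℕ) → b < M → ∑Range a b f ≡ ∑ M (λ h → restrict a b h (f h))
  ∑Range-as-∑ a b M f b<M = sym (begin
    ∑ M g                                              ≡⟨ cong (λ k → ∑ k g) (m+[n∸m]≡n b<M) ⟨
    ∑ (suc b + (M ∸ suc b)) g                          ≡⟨ ∑-split (suc b) (M ∸ suc b) g ⟩
    ∑ (suc b) g + ∑ (M ∸ suc b) (λ i → g (suc b + i))  ≡⟨ cong (∑ (suc b) g +_) (∑-zero (M ∸ suc b) _ (λ i _ →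
                                                            restrict-above a b (s≤s (m≤m+n b i)))) ⟩
    ∑ (suc b) g + 0                                    ≡⟨ +-identityʳ _ ⟩
    ∑ (suc b) g                                        ≡⟨ up-to-b ⟩
    ∑Range a b f                                       ∎)
    where
    g : ℕ → ℕ
    g h = restrict a b h (f h)
    up-to-b : ∑ (suc b) g ≡ ∑Range a b f
    up-to-b with a ≤? suc b
    ... | yes a≤1+b = begin
      ∑ (suc b) g                                      ≡⟨ cong (λ k → ∑ k g) (m+[n∸m]≡n a≤1+b) ⟨
      ∑ (a + (suc b ∸ a)) g                            ≡⟨ ∑-split a (suc b ∸ a) g ⟩
      ∑ a g + ∑ (suc b ∸ a) (λ i → g (a + i))          ≡⟨ cong₂ _+_ (∑-zero a g (λ _ → restrict-below a b))
                                                                    (∑-cong-< (suc b ∸ a) (λ i i< → restrict-in a b (m≤m+n a i) (in-range i i<))) ⟩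
      ∑Range a b f                                     ∎
      where
      in-range : ∀ i → i < suc b ∸ a → a + i ≤ b
      in-range i i< = subst (_≤ b) (+-comm i a) (≤-pred (m≤o∸n⇒m+n≤o (suc i) a≤1+b i<))
    ... | no a≰1+b = trans (∑-zero (suc b) g (λ i i<1+b → restrict-below a b (<-≤-trans i<1+b (<⇒≤ (≰⇒> a≰1+b)))))
                           (cong (λ k → ∑ k (λ i → f (a + i))) (sym (m≤n⇒m∸n≡0 (<⇒≤ (≰⇒> a≰1+b)))))

  -- Binomial coefficients

  binom : ℕ → ℕ → ℕ
  binom n       zero    = 1
  binom zero    (suc k) = 0
  binom (suc n) (suc k) = binom n k + binom n (suc k)

  C≡binom : ∀ n k → n C k ≡ binom n k
  C≡binom n       zero    = refl
  C≡binom zero    (suc k) = refl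
  C≡binom (suc n) (suc k) =
    trans (sym (nCk+nC[k+1]≡[n+1]C[k+1] n k)) (cong₂ _+_ (C≡binom n k) (C≡binom n (suc k)))

  binom-< : ∀ {n k} → n < k → binom n k ≡ 0
  binom-< {zero}  {suc k} _         = refl
  binom-< {suc n} {suc k} (s<s n<k) = cong₂ _+_ (binom-< n<k) (binom-< (m<n⇒m<1+n n<k))

  binom-diag : ∀ n → binom n n ≡ 1
  binom-diag zero    = refl
  binom-diag (suc n) = cong₂ _+_ (binom-diag n) (binom-< (n<1+n n))

  binom-1 : ∀ n → binom n 1 ≡ n
  binom-1 zero    = refl
  binom-1 (suc n) = cong suc (binom-1 n)

  binom-absorb : ∀ n k → suc k * binom (suc n) (suc k) ≡ suc n * binom n k
  binom-absorb zero    zero    = refl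
  binom-absorb zero    (suc k) = *-zeroʳ (suc (suc k))
  binom-absorb (suc n) zero    = cong (suc ∘ suc) (trans (+-identityʳ _) (trans (binom-1 n) (sym (*-identityʳ n))))
  binom-absorb (suc n) (suc k) = begin
    suc (suc k) * (X + binom (suc n) (suc (suc k)))
      ≡⟨ *-distribˡ-+ (suc (suc k)) X _ ⟩
    suc (suc k) * X + suc (suc k) * binom (suc n) (suc (suc k))
      ≡⟨ cong (suc (suc k) * X +_) (binom-absorb n (suc k)) ⟩
    X + suc k * X + suc n * binom n (suc k)
      ≡⟨ cong (λ z → X + z + suc n * binom n (suc k)) (binom-absorb n k) ⟩
    X + suc n * binom n k + suc n * binom n (suc k)
      ≡⟨ +-assoc X _ _ ⟩
    X + (suc n * binom n k + suc n * binom n (suc k))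
      ≡⟨ cong (X +_) (*-distribˡ-+ (suc n) (binom n k) _) ⟨
    X + suc n * X ∎
    where X = binom (suc n) (suc k)

  binom-subset : ∀ n h l → l ≤ h → binom n h * binom h l ≡ binom n l * binom (n ∸ l) (h ∸ l)
  binom-subset n       h       zero    _         = trans (*-identityʳ _) (sym (*-identityˡ _))
  binom-subset zero    (suc h) (suc l) _         = refl
  binom-subset (suc n) (suc h) (suc l) (s≤s l≤h) = *-cancelˡ-≡ _ _ (suc l) (begin
    suc l * (X * binom (suc h) (suc l))       ≡⟨ *-CS.x∙yz≈y∙xz (suc l) X _ ⟩
    X * (suc l * binom (suc h) (suc l))       ≡⟨ cong (X *_) (binom-absorb h l) ⟩
    X * (suc h * binom h l)                   ≡⟨ *-CS.x∙yz≈yx∙z X (suc h) _ ⟩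
    (suc h * X) * binom h l                   ≡⟨ cong (_* binom h l) (binom-absorb n h) ⟩
    (suc n * binom n h) * binom h l           ≡⟨ *-assoc (suc n) (binom n h) (binom h l) ⟩
    suc n * (binom n h * binom h l)           ≡⟨ cong (suc n *_) (binom-subset n h l l≤h) ⟩
    suc n * (binom n l * D)                   ≡⟨ *-assoc (suc n) (binom n l) D ⟨
    (suc n * binom n l) * D                   ≡⟨ cong (_* D) (binom-absorb n l) ⟨
    (suc l * binom (suc n) (suc l)) * D       ≡⟨ *-assoc (suc l) (binom (suc n) (suc l)) D ⟩
    suc l * (binom (suc n) (suc l) * D)       ∎)
    where
    X = binom (suc n) (suc h)
    D = binom (n ∸ l) (h ∸ l)

  toℕ : Bool → ℕ
  toℕ b = if b then 1 else 0

  sumOver : {A : Set} → (A → ℕ) → List A → ℕ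
  sumOver f []       = 0
  sumOver f (x ∷ xs) = f x + sumOver f xs

  length-filter : ∀ {A : Set} (p : A → Bool) xs →
                  length (filter (λ x → p x Bool.≟ true) xs) ≡ sumOver (toℕ ∘ p) xs
  length-filter p []       = refl
  length-filter p (x ∷ xs) with p x
  ... | true  = cong suc (length-filter p xs)
  ... | false = length-filter p xs

  sumOver-applyUpTo : ∀ {A : Set} (g : A → ℕ) n f → sumOver g (applyUpTo f n) ≡ ∑ n (g ∘ f)
  sumOver-applyUpTo g zero    f = refl
  sumOver-applyUpTo g (suc n) f = cong (g (f 0) +_) (sumOver-applyUpTo g n (f ∘ suc))

  module _ {A : Set} where

    sumOver-cong : ∀ {f g : A → ℕ} xs → (∀ x → f x ≡ g x) → sumOver f xs ≡ sumOver g xs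
    sumOver-cong []       eq = refl
    sumOver-cong (x ∷ xs) eq = cong₂ _+_ (eq x) (sumOver-cong xs eq)

    sumOver-0 : ∀ xs → sumOver {A} (λ _ → 0) xs ≡ 0
    sumOver-0 []       = refl
    sumOver-0 (x ∷ xs) = sumOver-0 xs

    sumOver-+ : ∀ (f g : A → ℕ) xs → sumOver (λ x → f x + g x) xs ≡ sumOver f xs + sumOver g xs
    sumOver-+ f g []       = refl
    sumOver-+ f g (x ∷ xs) = trans (cong (f x + g x +_) (sumOver-+ f g xs)) (+-CS.interchange (f x) (g x) _ _)

    sumOver-*ʳ : ∀ (f : A → ℕ) c xs → sumOver (λ x → f x * c) xs ≡ sumOver f xs * c
    sumOver-*ʳ f c []       = refl
    sumOver-*ʳ f c (x ∷ xs) = trans (cong (f x * c +_) (sumOver-*ʳ f c xs)) (sym (*-distribʳ-+ c (f x) _))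

    sumOver-∑ : ∀ n (f : ℕ → A → ℕ) xs → sumOver (λ x → ∑ n (λ j → f j x)) xs ≡ ∑ n (λ j → sumOver (f j) xs)
    sumOver-∑ zero    f xs = sumOver-0 xs
    sumOver-∑ (suc n) f xs =
      trans (sumOver-+ (f 0) _ xs) (cong (sumOver (f 0) xs +_) (sumOver-∑ n (f ∘ suc) xs))

  sumOver-allWords-∷ : ∀ (f : List Bool → ℕ) k →
                       sumOver f (allWords (suc k)) ≡ sumOver (λ v → f (false ∷ v) + f (true ∷ v)) (allWords k)
  sumOver-allWords-∷ f k = go (allWords k)
    where
    go : ∀ ws → sumOver f (concatMap (λ w → (false ∷ w) ∷ (true ∷ w) ∷ []) ws)
              ≡ sumOver (λ v → f (false ∷ v) + f (true ∷ v)) ws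
    go []       = refl
    go (v ∷ ws) = trans (sym (+-assoc (f (false ∷ v)) _ _)) (cong (f (false ∷ v) + f (true ∷ v) +_) (go ws))

  sumOver-allWords-∷ʳ : ∀ k (f : List Bool → ℕ) →
                        sumOver f (allWords (suc k)) ≡ sumOver (λ v → f (v ∷ʳ false) + f (v ∷ʳ true)) (allWords k)
  sumOver-allWords-∷ʳ zero    f = sym (+-assoc (f (false ∷ [])) _ 0)
  sumOver-allWords-∷ʳ (suc k) f = begin
    sumOver f (allWords (suc (suc k)))                              ≡⟨ sumOver-allWords-∷ f (suc k) ⟩
    sumOver g (allWords (suc k))                                    ≡⟨ sumOver-allWords-∷ʳ k g ⟩
    sumOver (λ v → g (v ∷ʳ false) + g (v ∷ʳ true)) (allWords k)     ≡⟨ sumOver-cong (allWords k) (λ v →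
                                                                         +-CS.interchange (f (false ∷ v ∷ʳ false)) (f (true ∷ v ∷ʳ false)) _ _) ⟩
    sumOver (λ u → h (false ∷ u) + h (true ∷ u)) (allWords k)       ≡⟨ sumOver-allWords-∷ h k ⟨
    sumOver h (allWords (suc k))                                    ∎
    where
    g h : List Bool → ℕ
    g w = f (false ∷ w) + f (true ∷ w)
    h v = f (v ∷ʳ false) + f (v ∷ʳ true)

  rotate : List Bool → List Bool
  rotate []      = []
  rotate (x ∷ v) = v ∷ʳ x

  sumOver-allWords-rotate : ∀ k (f : List Bool → ℕ) → sumOver (f ∘ rotate) (allWords k) ≡ sumOver f (allWords k)
  sumOver-allWords-rotate zero    f = refl
  sumOver-allWords-rotate (suc k) f = trans (sumOver-allWords-∷ (f ∘ rotate) k) (sym (sumOver-allWords-∷ʳ k f))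

  sumOver-allWords-cong : ∀ k {f g : List Bool → ℕ} → (∀ w → length w ≡ k → f w ≡ g w) →
                          sumOver f (allWords k) ≡ sumOver g (allWords k)
  sumOver-allWords-cong zero    eq = cong (_+ 0) (eq [] refl)
  sumOver-allWords-cong (suc k) {f} {g} eq = begin
    sumOver f (allWords (suc k))                                ≡⟨ sumOver-allWords-∷ f k ⟩
    sumOver (λ v → f (false ∷ v) + f (true ∷ v)) (allWords k)   ≡⟨ sumOver-allWords-cong k (λ w e →
                                                                     cong₂ _+_ (eq (false ∷ w) (cong suc e)) (eq (true ∷ w) (cong suc e))) ⟩
    sumOver (λ v → g (false ∷ v) + g (true ∷ v)) (allWords k)   ≡⟨ sumOver-allWords-∷ g k ⟨
    sumOver g (allWords (suc k))                                ∎

  cycOcc-∑ : ∀ U S → cycOcc U S ≡ ∑ (length S) (λ i → toℕ (isPrefix U (drop i (S ++ S))))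
  cycOcc-∑ U S = trans (length-filter p (upTo (length S))) (sumOver-applyUpTo (toℕ ∘ p) (length S) (λ i → i))
    where
    p : ℕ → Bool
    p i = isPrefix U (drop i (S ++ S))

  isPrefix-++ : ∀ U A B → length U ≤ length A → isPrefix U (A ++ B) ≡ isPrefix U A
  isPrefix-++ []      A       B _         = refl
  isPrefix-++ (u ∷ U) (a ∷ A) B (s≤s U≤A) = cong (eqB u a ∧_) (isPrefix-++ U A B U≤A)

  isPrefix-drop-++ : ∀ U i A B → i + length U ≤ length A → isPrefix U (drop i (A ++ B)) ≡ isPrefix U (drop i A)
  isPrefix-drop-++ U zero    A       B U≤A       = isPrefix-++ U A B U≤A
  isPrefix-drop-++ U (suc i) (a ∷ A) B (s≤s fit) = isPrefix-drop-++ U i A B fit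

  drop-length-++ : ∀ (A B : List Bool) → drop (length A) (A ++ B) ≡ B
  drop-length-++ []      B = refl
  drop-length-++ (a ∷ A) B = drop-length-++ A B

  cycOcc-rotate : ∀ U x v → length U ≤ length v → cycOcc U (rotate (x ∷ v)) ≡ cycOcc U (x ∷ v)
  cycOcc-rotate U x v U≤v = begin
    cycOcc U (v ∷ʳ x)                          ≡⟨ cycOcc-∑ U (v ∷ʳ x) ⟩
    ∑ (length (v ∷ʳ x)) g                      ≡⟨ cong (λ k → ∑ k g) (trans (length-++ v) (+-comm L 1)) ⟩
    ∑ (suc L) g                                ≡⟨ ∑-cong-< (suc L) g≡f∘suc ⟩
    ∑ (suc L) (f ∘ suc)                        ≡⟨ ∑-suc L (f ∘ suc) ⟩
    ∑ L (f ∘ suc) + f (suc L)                  ≡⟨ cong (∑ L (f ∘ suc) +_) f[1+L]≡f0 ⟩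
    ∑ L (f ∘ suc) + f 0                        ≡⟨ +-comm _ (f 0) ⟩
    ∑ (suc L) f                                ≡⟨ cycOcc-∑ U (x ∷ v) ⟨
    cycOcc U (x ∷ v)                           ∎
    where
    L = length v
    W = v ++ x ∷ v
    f g : ℕ → ℕ
    f i = toℕ (isPrefix U (drop i ((x ∷ v) ++ (x ∷ v))))
    g i = toℕ (isPrefix U (drop i ((v ∷ʳ x) ++ (v ∷ʳ x))))
    rotated-square : (v ∷ʳ x) ++ (v ∷ʳ x) ≡ W ++ x ∷ []
    rotated-square = trans (++-assoc v (x ∷ []) (v ∷ʳ x)) (sym (++-assoc v (x ∷ v) (x ∷ [])))
    g≡f∘suc : ∀ i → i < suc L → g i ≡ f (suc i)
    g≡f∘suc i (s≤s i≤L) = cong toℕ (begin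
      isPrefix U (drop i ((v ∷ʳ x) ++ (v ∷ʳ x)))  ≡⟨ cong (isPrefix U ∘ drop i) rotated-square ⟩
      isPrefix U (drop i (W ++ x ∷ []))           ≡⟨ isPrefix-drop-++ U i W (x ∷ []) fits ⟩
      isPrefix U (drop i W)                       ∎)
      where
      fits : i + length U ≤ length W
      fits = ≤-trans (+-mono-≤ (m≤n⇒m≤1+n i≤L) U≤v) (≤-trans (≤-reflexive (+-comm (suc L) L)) (≤-reflexive (sym (length-++ v))))
    f[1+L]≡f0 : f (suc L) ≡ f 0
    f[1+L]≡f0 = cong toℕ (trans (cong (isPrefix U) (drop-length-++ v (x ∷ v)))
                                (sym (isPrefix-++ U (x ∷ v) (x ∷ v) (m≤n⇒m≤1+n U≤v))))

  data Run : Set where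
    run0 run1 run2 : Run

  extend : Run → Run
  extend run0 = run1
  extend run1 = run2
  extend run2 = run2

  -- occ s v counts the occurrences of 001 in z v 1, where z is empty, 0 or 00 for s = run0, run1, run2.
  occ : Run → List Bool → ℕ
  occ run0 []          = 0
  occ run1 []          = 0
  occ run2 []          = 1
  occ s    (false ∷ v) = occ (extend s) v
  occ run0 (true ∷ v)  = occ run0 v
  occ run1 (true ∷ v)  = occ run0 v
  occ run2 (true ∷ v)  = suc (occ run0 v)

  occurs001 : List Bool → ℕ
  occurs001 = toℕ ∘ isPrefix w001

  -- An occurrence starting inside v ends at the latest in the 1 after v, whatever u is.
  occ-∑ : ∀ u v → let count = ∑ (length v) (λ i → occurs001 (drop i (v ++ true ∷ u))) in
          occ run0 v ≡ count
          × occ run1 v ≡ occurs001 (false ∷ v ++ true ∷ u) + count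
          × occ run2 v ≡ occurs001 (false ∷ false ∷ v ++ true ∷ u) + occurs001 (false ∷ v ++ true ∷ u) + count
  occ-∑ u []          = refl , refl , refl
  occ-∑ u (true ∷ v)  with occ-∑ u v
  ... | e0 , _ , _    = e0 , e0 , cong suc e0
  occ-∑ u (false ∷ v) with occ-∑ u v
  ... | _ , e1 , e2   = e1 , trans e2 (+-assoc (occurs001 (false ∷ false ∷ v ++ true ∷ u)) _ _)
                           , trans e2 (+-assoc (occurs001 (false ∷ false ∷ v ++ true ∷ u)) _ _)

  cycOcc-001-true∷ : ∀ v → cycOcc w001 (true ∷ v) ≡ occ run0 v
  cycOcc-001-true∷ v = trans (cycOcc-∑ w001 (true ∷ v)) (sym (proj₁ (occ-∑ v v)))

  -- Double counting over rotations

  countLetter-rotate : ∀ b x v → countLetter b (rotate (x ∷ v)) ≡ countLetter b (x ∷ v)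
  countLetter-rotate b x []      = refl
  countLetter-rotate b x (y ∷ v) = trans (cong (toℕ (eqB b y) +_) (countLetter-rotate b x v))
                                         (+-CS.x∙yz≈y∙xz (toℕ (eqB b y)) (toℕ (eqB b x)) (countLetter b v))

  leadingOne : List Bool → ℕ
  leadingOne []      = 0
  leadingOne (x ∷ _) = toℕ (eqB true x)

  ones-∑-rotations : ∀ u v → ∑ (length u) (leadingOne ∘ iterate rotate (u ++ v)) ≡ countLetter true u
  ones-∑-rotations []      v = refl
  ones-∑-rotations (x ∷ u) v = cong (toℕ (eqB true x) +_) (begin
    ∑ (length u) (λ j → leadingOne (iterate rotate ((u ++ v) ∷ʳ x) j))
      ≡⟨ ∑-cong (length u) (λ j → cong (λ w → leadingOne (iterate rotate w j)) (++-assoc u v (x ∷ []))) ⟩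
    ∑ (length u) (λ j → leadingOne (iterate rotate (u ++ v ∷ʳ x) j))
      ≡⟨ ones-∑-rotations u (v ∷ʳ x) ⟩
    countLetter true u ∎)

  counted : ℕ → ℕ → ℕ → List Bool → ℕ
  counted m n ℓ w = toℕ ((countLetter false w ≡ᵇ m) ∧ (countLetter true w ≡ᵇ n) ∧ (cycOcc w001 w ≡ᵇ ℓ))

  T≡sumOver-counted : ∀ m n ℓ → T m n ℓ w001 ≡ sumOver (counted m n ℓ) (allWords (m + n))
  T≡sumOver-counted m n ℓ = length-filter _ (allWords (m + n))

  counted-*-ones : ∀ m n ℓ w → counted m n ℓ w * n ≡ counted m n ℓ w * countLetter true w
  counted-*-ones m n ℓ w with countLetter false w ≡ᵇ m
  ... | false = refl
  ... | true with countLetter true w ≡ᵇ n in ones≡ᵇn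
  ...   | false = refl
  ...   | true  = cong (toℕ (cycOcc w001 w ≡ᵇ ℓ) *_)
                       (sym (≡ᵇ⇒≡ (countLetter true w) n (subst Bool.T (sym ones≡ᵇn) tt)))

  counted-rotate : ∀ m n ℓ w → 4 ≤ length w → counted m n ℓ (rotate w) ≡ counted m n ℓ w
  counted-rotate m n ℓ (x ∷ v) (s≤s 3≤v)
    rewrite countLetter-rotate false x v | countLetter-rotate true x v | cycOcc-rotate w001 x v 3≤v = refl

  counted-∑-rotations : ∀ m n ℓ K → 4 ≤ K → ∀ j →
    sumOver (λ w → counted m n ℓ w * leadingOne (iterate rotate w j)) (allWords K)
    ≡ sumOver (λ w → counted m n ℓ w * leadingOne w) (allWords K)
  counted-∑-rotations m n ℓ K 4≤K zero    = refl
  counted-∑-rotations m n ℓ K 4≤K (suc j) = begin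
    sumOver (λ w → P w * leadingOne (iterate rotate (rotate w) j)) (allWords K)
      ≡⟨ sumOver-allWords-cong K (λ w |w|≡K →
           cong (_* _) (sym (counted-rotate m n ℓ w (subst (4 ≤_) (sym |w|≡K) 4≤K)))) ⟩
    sumOver (λ w → P (rotate w) * leadingOne (iterate rotate (rotate w) j)) (allWords K)
      ≡⟨ sumOver-allWords-rotate K (λ u → P u * leadingOne (iterate rotate u j)) ⟩
    sumOver (λ w → P w * leadingOne (iterate rotate w j)) (allWords K)
      ≡⟨ counted-∑-rotations m n ℓ K 4≤K j ⟩
    sumOver (λ w → P w * leadingOne w) (allWords K) ∎
    where P = counted m n ℓ

  -- A counted word has n ones, each at the front of exactly one of its N rotations, and
  -- rotating permutes the counted words.
  sumOver-counted-*-n : ∀ m n ℓ K → 4 ≤ suc K →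
    sumOver (counted m n ℓ) (allWords (suc K)) * n ≡ suc K * sumOver (λ v → counted m n ℓ (true ∷ v)) (allWords K)
  sumOver-counted-*-n m n ℓ K 4≤N = begin
    sumOver P (allWords N) * n                                      ≡⟨ sumOver-*ʳ P n (allWords N) ⟨
    sumOver (λ w → P w * n) (allWords N)                            ≡⟨ sumOver-cong (allWords N) (counted-*-ones m n ℓ) ⟩
    sumOver (λ w → P w * countLetter true w) (allWords N)           ≡⟨ sumOver-allWords-cong N (λ w |w|≡N →
                                                                         cong (P w *_) (sym (ones-as-∑ w |w|≡N))) ⟩
    sumOver (λ w → P w * ∑ N (rotationLeads w)) (allWords N)        ≡⟨ sumOver-cong (allWords N) (λ w →
                                                                         *-distribˡ-∑ N (P w) (rotationLeads w)) ⟩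
    sumOver (λ w → ∑ N (λ j → P w * rotationLeads w j)) (allWords N) ≡⟨ sumOver-∑ N (λ j w → P w * rotationLeads w j) (allWords N) ⟩
    ∑ N (λ j → sumOver (λ w → P w * rotationLeads w j) (allWords N)) ≡⟨ ∑-cong N (counted-∑-rotations m n ℓ N 4≤N) ⟩
    ∑ N (λ _ → sumOver (λ w → P w * leadingOne w) (allWords N))     ≡⟨ ∑-const N _ ⟩
    N * sumOver (λ w → P w * leadingOne w) (allWords N)             ≡⟨ cong (N *_) (trans (sumOver-allWords-∷ _ K)
                                                                         (sumOver-cong (allWords K) only-true)) ⟩
    N * sumOver (λ v → P (true ∷ v)) (allWords K)                   ∎
    where
    N = suc K
    P = counted m n ℓ
    rotationLeads : List Bool → ℕ → ℕ
    rotationLeads w = leadingOne ∘ iterate rotate w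
    ones-as-∑ : ∀ w → length w ≡ N → ∑ N (rotationLeads w) ≡ countLetter true w
    ones-as-∑ w |w|≡N = begin
      ∑ N (rotationLeads w)                                         ≡⟨ cong (λ k → ∑ k (rotationLeads w)) (sym |w|≡N) ⟩
      ∑ (length w) (rotationLeads w)                                ≡⟨ ∑-cong (length w) (λ j →
                                                                         cong (λ u → leadingOne (iterate rotate u j)) (sym (++-identityʳ w))) ⟩
      ∑ (length w) (leadingOne ∘ iterate rotate (w ++ []))          ≡⟨ ones-∑-rotations w [] ⟩
      countLetter true w                                            ∎
    only-true : ∀ v → P (false ∷ v) * 0 + P (true ∷ v) * 1 ≡ P (true ∷ v)
    only-true v = cong₂ _+_ (*-zeroʳ (P (false ∷ v))) (*-identityʳ (P (true ∷ v)))

  -- runCount s a b ℓ is the number of words v with a zeros, b ones and occ s v ≡ ℓ.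
  mutual
    runCount : Run → ℕ → ℕ → ℕ → ℕ
    runCount s zero    zero    ℓ = toℕ (occ s [] ≡ᵇ ℓ)
    runCount s (suc a) zero    ℓ = runCount (extend s) a zero ℓ
    runCount s zero    (suc b) ℓ = runCountAfterOne s zero b ℓ
    runCount s (suc a) (suc b) ℓ = runCount (extend s) a (suc b) ℓ + runCountAfterOne s (suc a) b ℓ

    runCountAfterOne : Run → ℕ → ℕ → ℕ → ℕ
    runCountAfterOne run0 a b ℓ       = runCount run0 a b ℓ
    runCountAfterOne run1 a b ℓ       = runCount run0 a b ℓ
    runCountAfterOne run2 a b zero    = 0
    runCountAfterOne run2 a b (suc ℓ) = runCount run0 a b ℓ

  matching : Run → ℕ → ℕ → ℕ → List Bool → ℕ
  matching s a b ℓ v = toℕ ((countLetter false v ≡ᵇ a) ∧ (countLetter true v ≡ᵇ b) ∧ (occ s v ≡ᵇ ℓ))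

  counted-true∷ : ∀ m n ℓ v → counted m (suc n) ℓ (true ∷ v) ≡ matching run0 m n ℓ v
  counted-true∷ m n ℓ v rewrite cycOcc-001-true∷ v = refl

  matching-false∷ : ∀ s a b ℓ v → matching s (suc a) b ℓ (false ∷ v) ≡ matching (extend s) a b ℓ v
  matching-false∷ run0 a b ℓ v = refl
  matching-false∷ run1 a b ℓ v = refl
  matching-false∷ run2 a b ℓ v = refl

  sumOver-matching-true∷-no-ones : ∀ s a ℓ K → sumOver (λ v → matching s a zero ℓ (true ∷ v)) (allWords K) ≡ 0
  sumOver-matching-true∷-no-ones s a ℓ K = trans (sumOver-cong (allWords K) (λ v → ∧-false-∧ (countLetter false v ≡ᵇ a) (occ s (true ∷ v) ≡ᵇ ℓ))) (sumOver-0 (allWords K))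
    where
    ∧-false-∧ : ∀ x y → toℕ (x ∧ false ∧ y) ≡ 0
    ∧-false-∧ false y = refl
    ∧-false-∧ true  y = refl

  sumOver-matching-true∷ : ∀ s a b ℓ K → (∀ ℓ′ → sumOver (matching run0 a b ℓ′) (allWords K) ≡ runCount run0 a b ℓ′) →
              sumOver (λ v → matching s a (suc b) ℓ (true ∷ v)) (allWords K) ≡ runCountAfterOne s a b ℓ
  sumOver-matching-true∷ run0 a b ℓ       K ih = ih ℓ
  sumOver-matching-true∷ run1 a b ℓ       K ih = ih ℓ
  sumOver-matching-true∷ run2 a b (suc ℓ) K ih = ih ℓ
  sumOver-matching-true∷ run2 a b zero    K ih = trans (sumOver-cong (allWords K) (λ v → ∧-∧-false (countLetter false v ≡ᵇ a) (countLetter true v ≡ᵇ b))) (sumOver-0 (allWords K))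
    where
    ∧-∧-false : ∀ x y → toℕ (x ∧ y ∧ false) ≡ 0
    ∧-∧-false false y     = refl
    ∧-∧-false true  false = refl
    ∧-∧-false true  true  = refl

  sumOver-matching : ∀ K s a b ℓ → K ≡ a + b → sumOver (matching s a b ℓ) (allWords K) ≡ runCount s a b ℓ
  sumOver-matching zero    s zero zero ℓ _ = +-identityʳ _
  sumOver-matching (suc K) s a b ℓ K≡a+b =
    trans (sumOver-allWords-∷ (matching s a b ℓ) K)
          (trans (sumOver-+ (λ v → matching s a b ℓ (false ∷ v)) (λ v → matching s a b ℓ (true ∷ v)) (allWords K))
                 (split a b K≡a+b))
    where
    split : ∀ a b → suc K ≡ a + b →
            sumOver (λ v → matching s a b ℓ (false ∷ v)) (allWords K) + sumOver (λ v → matching s a b ℓ (true ∷ v)) (allWords K)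
            ≡ runCount s a b ℓ
    split zero    (suc b) e = trans (cong₂ _+_ (sumOver-0 (allWords K)) refl)
                                    (sumOver-matching-true∷ s zero b ℓ K (λ ℓ′ → sumOver-matching K run0 zero b ℓ′ (suc-injective e)))
    split (suc a) zero    e = trans (cong₂ _+_ (sumOver-cong (allWords K) (matching-false∷ s a zero ℓ)) (sumOver-matching-true∷-no-ones s (suc a) ℓ K))
                                    (trans (+-identityʳ _) (sumOver-matching K (extend s) a zero ℓ (suc-injective e)))
    split (suc a) (suc b) e = cong₂ _+_
      (trans (sumOver-cong (allWords K) (matching-false∷ s a (suc b) ℓ)) (sumOver-matching K (extend s) a (suc b) ℓ (suc-injective e)))
      (sumOver-matching-true∷ s (suc a) b ℓ K (λ ℓ′ → sumOver-matching K run0 (suc a) b ℓ′ (trans (suc-injective e) (+-suc a b))))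

  -- The closed form of runCount

  -- P x k = binom (x ∸ k ∸ 2) k for x ≥ 2k + 2, and 0 otherwise (P-closed-form, P-vanishes).
  P : ℕ → ℕ → ℕ
  P zero          k       = 0
  P (suc zero)    k       = 0
  P (suc (suc t)) zero    = 1
  P (suc (suc t)) (suc k) = P (suc t) (suc k) + P t k

  P-hockey-stick : ∀ m k → P m (suc k) ≡ ∑ (m ∸ 1) (λ j → P j k)
  P-hockey-stick zero          k = refl
  P-hockey-stick (suc zero)    k = refl
  P-hockey-stick (suc (suc t)) k = trans (cong (_+ P t k) (P-hockey-stick (suc t) k)) (sym (∑-suc t (λ j → P j k)))

  P-vanishes : ∀ k x → x < suc (suc (k + k)) → P x k ≡ 0
  P-vanishes zero    zero          _ = refl
  P-vanishes zero    (suc zero)    _ = refl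
  P-vanishes zero    (suc (suc x)) (s≤s (s≤s ()))
  P-vanishes (suc k) zero          _ = refl
  P-vanishes (suc k) (suc zero)    _ = refl
  P-vanishes (suc k) (suc (suc t)) t+2<2k+4 =
    cong₂ _+_ (P-vanishes (suc k) (suc t) (<-trans (n<1+n (suc t)) t+2<2k+4))
              (P-vanishes k t (≤-pred (≤-pred (≤-trans t+2<2k+4 (≤-reflexive (cong (suc ∘ suc ∘ suc) (+-suc k k)))))))

  P-closed-form : ∀ k r → P (suc (suc (k + k)) + r) k ≡ binom (k + r) k
  P-closed-form zero    r = refl
  P-closed-form (suc k) r = trans (cong (λ x → P (suc (suc x + r)) (suc k)) (+-suc (suc k) k)) (shifted r)
    where
    shifted : ∀ r → P (suc (suc (suc (suc (k + k)) + r))) (suc k) ≡ binom (suc k + r) (suc k)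
    shifted zero = begin
      P (suc (suc (suc (k + k)) + 0)) (suc k) + P (suc (suc (k + k)) + 0) k
        ≡⟨ cong₂ _+_ (P-vanishes (suc k) _ (s≤s (s≤s (s≤s (≤-reflexive (trans (+-identityʳ _) (sym (+-suc k k)))))))) (P-closed-form k 0) ⟩
      binom (k + 0) k                   ≡⟨ trans (cong (λ x → binom x k) (+-identityʳ k)) (binom-diag k) ⟩
      1                                 ≡⟨ trans (cong (λ x → binom x (suc k)) (+-identityʳ (suc k))) (binom-diag (suc k)) ⟨
      binom (suc k + 0) (suc k)         ∎
    shifted (suc r) = begin
      P (suc (suc (suc (k + k)) + suc r)) (suc k) + P (suc (suc (k + k)) + suc r) k
        ≡⟨ cong₂ _+_ (cong (λ x → P (suc x) (suc k)) (+-suc (suc (suc (k + k))) r)) (P-closed-form k (suc r)) ⟩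
      P (suc (suc (suc (suc (k + k)) + r))) (suc k) + binom (k + suc r) k
        ≡⟨ cong₂ _+_ (shifted r) (cong (λ x → binom x k) (+-suc k r)) ⟩
      binom (suc k + r) (suc k) + binom (suc k + r) k
        ≡⟨ +-comm (binom (suc k + r) (suc k)) _ ⟩
      binom (suc (suc k + r)) (suc k)   ≡⟨ cong (λ x → binom (suc x) (suc k)) (+-suc k r) ⟨
      binom (suc k + suc r) (suc k)     ∎

  P-∸ : ∀ k j m → suc (suc (k + k)) + j ≤ m → P (m ∸ j) k ≡ binom (m ∸ (suc k + j) ∸ 1) k
  P-∸ k j m 2k+2+j≤m = begin
    P (m ∸ j) k                   ≡⟨ cong (λ x → P x k) m∸j≡2k+2+r ⟩
    P (suc (suc (k + k)) + r) k   ≡⟨ P-closed-form k r ⟩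
    binom (k + r) k               ≡⟨ cong (λ x → binom x k) index ⟨
    binom (m ∸ (suc k + j) ∸ 1) k ∎
    where
    r = m ∸ j ∸ suc (suc (k + k))
    m∸j≡2k+2+r : m ∸ j ≡ suc (suc (k + k)) + r
    m∸j≡2k+2+r = sym (m+[n∸m]≡n (m+n≤o⇒m≤o∸n (suc (suc (k + k))) {j} 2k+2+j≤m))
    1+k+j+1≡j+2+k : ∀ k j → suc k + j + 1 ≡ j + suc (suc k)
    1+k+j+1≡j+2+k = solve-∀
    index : m ∸ (suc k + j) ∸ 1 ≡ k + r
    index = begin
      m ∸ (suc k + j) ∸ 1                 ≡⟨ ∸-+-assoc m (suc k + j) 1 ⟩
      m ∸ (suc k + j + 1)                 ≡⟨ cong (m ∸_) (1+k+j+1≡j+2+k k j) ⟩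
      m ∸ (j + suc (suc k))               ≡⟨ ∸-+-assoc m j (suc (suc k)) ⟨
      m ∸ j ∸ suc (suc k)                 ≡⟨ cong (_∸ suc (suc k)) m∸j≡2k+2+r ⟩
      suc (suc (k + k)) + r ∸ suc (suc k) ≡⟨ cong (_∸ k) (+-assoc k k r) ⟩
      k + (k + r) ∸ k                     ≡⟨ m+n∸m≡n k (k + r) ⟩
      k + r                               ∎

  -- Pascal's rule in α, so that R α m 0 = binom α m (R-0) and R α m (k + 1) = ∑ⱼ binom α j * P (m ∸ j) k (R-suc-as-∑).
  R : ℕ → ℕ → ℕ → ℕ
  R zero    zero    zero    = 1
  R zero    (suc m) zero    = 0
  R zero    m       (suc k) = P m k
  R (suc α) zero    ℓ       = R α zero ℓ
  R (suc α) (suc m) ℓ       = R α (suc m) ℓ + R α m ℓ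

  R-zero-suc : ∀ m k → R zero m (suc k) ≡ P m k
  R-zero-suc zero    k = refl
  R-zero-suc (suc m) k = refl

  R-0 : ∀ α m → R α m 0 ≡ binom α m
  R-0 zero    zero    = refl
  R-0 zero    (suc m) = refl
  R-0 (suc α) zero    = R-0 α zero
  R-0 (suc α) (suc m) = trans (cong₂ _+_ (R-0 α (suc m)) (R-0 α m)) (+-comm (binom α (suc m)) (binom α m))

  ∑-R-suc : ∀ α ℓ t → ∑ (suc t) (λ j → R (suc α) j ℓ) ≡ ∑ (suc t) (λ j → R α j ℓ) + ∑ t (λ j → R α j ℓ)
  ∑-R-suc α ℓ t = trans (cong (R α 0 ℓ +_) (∑-+ t (λ j → R α (suc j) ℓ) (λ j → R α j ℓ))) (sym (+-assoc (R α 0 ℓ) _ _))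

  R-hockey-stick : ∀ α m ℓ → R α m (suc ℓ) ≡ ∑ (m ∸ 1) (λ j → R α j ℓ)
  R-hockey-stick zero    zero          zero    = refl
  R-hockey-stick zero    (suc zero)    zero    = refl
  R-hockey-stick zero    (suc (suc t)) zero    = cong suc (sym (∑-zero t (λ j → R zero (suc j) zero) (λ _ _ → refl)))
  R-hockey-stick zero    zero          (suc k) = refl
  R-hockey-stick zero    (suc m)       (suc k) = trans (P-hockey-stick (suc m) k) (∑-cong m (λ j → sym (R-zero-suc j k)))
  R-hockey-stick (suc α) zero          ℓ       = R-hockey-stick α zero ℓ
  R-hockey-stick (suc α) (suc zero)    ℓ       = cong₂ _+_ (R-hockey-stick α 1 ℓ) (R-hockey-stick α 0 ℓ)
  R-hockey-stick (suc α) (suc (suc t)) ℓ       =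
    trans (cong₂ _+_ (R-hockey-stick α (suc (suc t)) ℓ) (R-hockey-stick α (suc t) ℓ)) (sym (∑-R-suc α ℓ t))

  R-suc-as-∑ : ∀ α m k → R α m (suc k) ≡ ∑ (suc α) (λ j → binom α j * P (m ∸ j) k)
  R-suc-as-∑ zero    m       k = trans (R-zero-suc m k) (sym (trans (+-identityʳ _) (*-identityˡ _)))
  R-suc-as-∑ (suc α) zero    k = trans (R-suc-as-∑ α zero k) (trans (no-zeros α) (sym (no-zeros (suc α))))
    where
    no-zeros : ∀ α → ∑ (suc α) (λ j → binom α j * P (0 ∸ j) k) ≡ 0
    no-zeros α = ∑-zero (suc α) _ (λ j _ → trans (cong (λ x → binom α j * P x k) (0∸n≡0 j)) (*-zeroʳ (binom α j)))
  R-suc-as-∑ (suc α) (suc m) k = trans (cong₂ _+_ (R-suc-as-∑ α (suc m) k) (R-suc-as-∑ α m k)) (sym (begin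
    P₀ + ∑ (suc α) (λ j → (binom α j + binom α (suc j)) * P (m ∸ j) k)
      ≡⟨ cong (P₀ +_) (trans (∑-cong (suc α) (λ j → *-distribʳ-+ (P (m ∸ j) k) (binom α j) (binom α (suc j))))
                             (∑-+ (suc α) (λ j → binom α j * P (m ∸ j) k) (λ j → binom α (suc j) * P (m ∸ j) k))) ⟩
    P₀ + (S + ∑ (suc α) (λ j → binom α (suc j) * P (m ∸ j) k))
      ≡⟨ cong (λ x → P₀ + (S + x)) (∑-suc α (λ j → binom α (suc j) * P (m ∸ j) k)) ⟩
    P₀ + (S + (S′ + binom α (suc α) * P (m ∸ α) k))
      ≡⟨ cong (λ x → P₀ + (S + (S′ + x * P (m ∸ α) k))) (binom-< (n<1+n α)) ⟩
    P₀ + (S + (S′ + 0))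
      ≡⟨ cong (λ x → P₀ + (S + x)) (+-identityʳ S′) ⟩
    P₀ + (S + S′)
      ≡⟨ +-CS.x∙yz≈xz∙y P₀ S S′ ⟩
    P₀ + S′ + S ∎))
    where
    P₀ = 1 * P (suc m) k
    S  = ∑ (suc α) (λ j → binom α j * P (m ∸ j) k)
    S′ = ∑ α (λ j → binom α (suc j) * P (m ∸ j) k)

  -- The recurrence of runCount run0 in the number of ones: a word starts with 1, 01 or 0ⁱ1 for
  -- some i ≥ 2, and only the last block completes an occurrence.
  withoutOnes : ℕ → ℕ → ℕ
  withoutOnes zero          ℓ = toℕ (0 ≡ᵇ ℓ)
  withoutOnes (suc zero)    ℓ = toℕ (0 ≡ᵇ ℓ)
  withoutOnes (suc (suc a)) ℓ = toℕ (1 ≡ᵇ ℓ)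

  oneZeroLess : (ℕ → ℕ → ℕ → ℕ) → ℕ → ℕ → ℕ → ℕ
  oneZeroLess F zero    b ℓ = 0
  oneZeroLess F (suc a) b ℓ = F a b ℓ

  closingRun : (ℕ → ℕ → ℕ → ℕ) → ℕ → ℕ → ℕ → ℕ
  closingRun F a b zero    = 0
  closingRun F a b (suc k) = ∑ (a ∸ 1) (λ j → F j b k)

  closingRun-short : ∀ F a b ℓ → a ≤ 1 → closingRun F a b ℓ ≡ 0
  closingRun-short F a             b zero    _                 = refl
  closingRun-short F zero          b (suc k) _                 = refl
  closingRun-short F (suc zero)    b (suc k) _                 = refl
  closingRun-short F (suc (suc a)) b (suc k) (s≤s ())

  record Recurrence (F : ℕ → ℕ → ℕ → ℕ) : Set where
    field
      initial : ∀ a ℓ → F a 0 ℓ ≡ withoutOnes a ℓ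
      step    : ∀ a b ℓ → F a (suc b) ℓ ≡ F a b ℓ + oneZeroLess F a b ℓ + closingRun F a b ℓ

  Recurrence-unique : ∀ {F G} → Recurrence F → Recurrence G → ∀ a b ℓ → F a b ℓ ≡ G a b ℓ
  Recurrence-unique {F} {G} recF recG a zero    ℓ = trans (Recurrence.initial recF a ℓ) (sym (Recurrence.initial recG a ℓ))
  Recurrence-unique {F} {G} recF recG a (suc b) ℓ =
    trans (Recurrence.step recF a b ℓ)
          (trans (cong₂ _+_ (cong₂ _+_ (ih a ℓ) (oneZeroLess-≡ a ℓ)) (closingRun-≡ a ℓ)) (sym (Recurrence.step recG a b ℓ)))
    where
    ih : ∀ a ℓ → F a b ℓ ≡ G a b ℓ
    ih a ℓ = Recurrence-unique recF recG a b ℓ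
    oneZeroLess-≡ : ∀ a ℓ → oneZeroLess F a b ℓ ≡ oneZeroLess G a b ℓ
    oneZeroLess-≡ zero    ℓ = refl
    oneZeroLess-≡ (suc a) ℓ = ih a ℓ
    closingRun-≡ : ∀ a ℓ → closingRun F a b ℓ ≡ closingRun G a b ℓ
    closingRun-≡ a zero    = refl
    closingRun-≡ a (suc k) = ∑-cong (a ∸ 1) (λ j → ih j k)

  runCount-run2-withoutOnes : ∀ c ℓ → runCount run2 c 0 ℓ ≡ toℕ (1 ≡ᵇ ℓ)
  runCount-run2-withoutOnes zero    ℓ = refl
  runCount-run2-withoutOnes (suc c) ℓ = runCount-run2-withoutOnes c ℓ

  runCount-run2 : ∀ c b ℓ → runCount run2 c (suc b) ℓ ≡ closingRun (runCount run0) (suc (suc c)) b ℓ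
  runCount-run2 zero    b zero    = refl
  runCount-run2 zero    b (suc k) = sym (+-identityʳ _)
  runCount-run2 (suc c) b zero    = trans (+-identityʳ _) (runCount-run2 c b zero)
  runCount-run2 (suc c) b (suc k) =
    trans (cong (_+ runCount run0 (suc c) b k) (runCount-run2 c b (suc k))) (sym (∑-suc (suc c) (λ j → runCount run0 j b k)))

  runCount-recurrence : Recurrence (runCount run0)
  runCount-recurrence = record { initial = initial ; step = step }
    where
    V = runCount run0
    initial : ∀ a ℓ → V a 0 ℓ ≡ withoutOnes a ℓ
    initial zero          ℓ = refl
    initial (suc zero)    ℓ = refl
    initial (suc (suc c)) ℓ = runCount-run2-withoutOnes c ℓ
    step : ∀ a b ℓ → V a (suc b) ℓ ≡ V a b ℓ + oneZeroLess V a b ℓ + closingRun V a b ℓ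
    step zero          b ℓ = sym (trans (cong (V 0 b ℓ + 0 +_) (closingRun-short V 0 b ℓ z≤n)) (trans (+-identityʳ _) (+-identityʳ _)))
    step (suc zero)    b ℓ = sym (trans (cong (V 1 b ℓ + V 0 b ℓ +_) (closingRun-short V 1 b ℓ (s≤s z≤n)))
                                        (trans (+-identityʳ _) (+-comm (V 1 b ℓ) (V 0 b ℓ))))
    step (suc (suc c)) b ℓ = begin
      runCount run2 c (suc b) ℓ + V (suc c) b ℓ + V (suc (suc c)) b ℓ  ≡⟨ cong (λ z → z + V (suc c) b ℓ + V (suc (suc c)) b ℓ) (runCount-run2 c b ℓ) ⟩
      X + V (suc c) b ℓ + V (suc (suc c)) b ℓ                          ≡⟨ +-CS.xy∙z≈zy∙x X _ _ ⟩
      V (suc (suc c)) b ℓ + V (suc c) b ℓ + X                          ∎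
      where
      X = closingRun V (suc (suc c)) b ℓ

  Y : ℕ → ℕ → ℕ → ℕ
  Y a b ℓ = binom (suc b) ℓ * R (suc b ∸ ℓ) a ℓ

  Y-initial : ∀ a ℓ → Y a 0 ℓ ≡ withoutOnes a ℓ
  Y-initial zero          zero          = refl
  Y-initial zero          (suc zero)    = refl
  Y-initial zero          (suc (suc k)) = refl
  Y-initial (suc zero)    zero          = refl
  Y-initial (suc zero)    (suc zero)    = refl
  Y-initial (suc zero)    (suc (suc k)) = refl
  Y-initial (suc (suc c)) zero          = refl
  Y-initial (suc (suc c)) (suc zero)    = refl
  Y-initial (suc (suc c)) (suc (suc k)) = refl

  Y-not-closing : ∀ a b k → binom (suc b) (suc k) * R (suc b ∸ k) a (suc k) ≡ Y a b (suc k) + oneZeroLess Y a b (suc k)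
  Y-not-closing a b k with k ≤? b
  ... | yes k≤b = trans (cong (λ α → binom (suc b) (suc k) * R α a (suc k)) (+-∸-assoc 1 k≤b)) (split a)
    where
    split : ∀ a → binom (suc b) (suc k) * R (suc (b ∸ k)) a (suc k) ≡ Y a b (suc k) + oneZeroLess Y a b (suc k)
    split zero    = sym (+-identityʳ _)
    split (suc a) = *-distribˡ-+ (binom (suc b) (suc k)) _ _
  ... | no k≰b = begin
    binom (suc b) (suc k) * R (suc b ∸ k) a (suc k)    ≡⟨ cong (_* R (suc b ∸ k) a (suc k)) vanishes ⟩
    0                                                  ≡⟨ vanishing a ⟨
    Y a b (suc k) + oneZeroLess Y a b (suc k)          ∎
    where
    vanishes : binom (suc b) (suc k) ≡ 0
    vanishes = binom-< (s≤s (≰⇒> k≰b))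
    vanishing : ∀ a → Y a b (suc k) + oneZeroLess Y a b (suc k) ≡ 0
    vanishing zero    = trans (+-identityʳ _) (cong (_* R (b ∸ k) zero (suc k)) vanishes)
    vanishing (suc a) = cong₂ _+_ (cong (_* R (b ∸ k) (suc a) (suc k)) vanishes) (cong (_* R (b ∸ k) a (suc k)) vanishes)

  Y-recurrence : Recurrence Y
  Y-recurrence = record { initial = Y-initial ; step = step }
    where
    step : ∀ a b ℓ → Y a (suc b) ℓ ≡ Y a b ℓ + oneZeroLess Y a b ℓ + closingRun Y a b ℓ
    step zero    b zero    = sym (trans (+-identityʳ _) (+-identityʳ _))
    step (suc a) b zero    =
      trans (*-identityˡ (X + X′)) (sym (trans (+-identityʳ _) (cong₂ _+_ (*-identityˡ X) (*-identityˡ X′))))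
      where
      X  = R (suc b) (suc a) 0
      X′ = R (suc b) a 0
    step a       b (suc k) = begin
      (binom (suc b) k + binom (suc b) (suc k)) * Rₐ                   ≡⟨ *-distribʳ-+ Rₐ (binom (suc b) k) _ ⟩
      binom (suc b) k * Rₐ + binom (suc b) (suc k) * Rₐ                ≡⟨ cong₂ _+_ closing (Y-not-closing a b k) ⟩
      closingRun Y a b (suc k) + (Y a b (suc k) + oneZeroLess Y a b (suc k)) ≡⟨ +-comm (closingRun Y a b (suc k)) _ ⟩
      Y a b (suc k) + oneZeroLess Y a b (suc k) + closingRun Y a b (suc k) ∎
      where
      Rₐ = R (suc b ∸ k) a (suc k)
      closing : binom (suc b) k * Rₐ ≡ closingRun Y a b (suc k)
      closing = trans (cong (binom (suc b) k *_) (R-hockey-stick (suc b ∸ k) a k))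
                      (*-distribˡ-∑ (a ∸ 1) (binom (suc b) k) (λ j → R (suc b ∸ k) j k))

  runCount≡Y : ∀ a b ℓ → runCount run0 a b ℓ ≡ Y a b ℓ
  runCount≡Y = Recurrence-unique runCount-recurrence Y-recurrence

  -- The two summation formulas

  binom*P-∸ : ∀ k α m j → j ≤ α →
    binom α j * P (m ∸ j) k ≡ restrict (suc k) ((m ∸ suc k) ⊓ (suc k + α)) (suc k + j) (binom (m ∸ (suc k + j) ∸ 1) k * binom α j)
  binom*P-∸ k α m j j≤α with suc k + j ≤? m ∸ suc k
  ... | yes h≤m∸ℓ = begin
    binom α j * P (m ∸ j) k                ≡⟨ cong (binom α j *_) (P-∸ k j m (subst (_≤ m) (trans (+-comm h ℓ) ℓ+h≡2k+2+j)
                                                                                 (m≤o∸n⇒m+n≤o′ z<s h≤m∸ℓ))) ⟩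
    binom α j * binom (m ∸ h ∸ 1) k        ≡⟨ *-comm (binom α j) _ ⟩
    binom (m ∸ h ∸ 1) k * binom α j        ≡⟨ restrict-in ℓ b (m≤m+n ℓ j) (⊓-glb h≤m∸ℓ (+-monoʳ-≤ ℓ j≤α)) ⟨
    restrict ℓ b h (binom (m ∸ h ∸ 1) k * binom α j) ∎
    where
    ℓ = suc k
    h = suc k + j
    b = (m ∸ suc k) ⊓ (suc k + α)
    ℓ+h≡2k+2+j : ℓ + h ≡ suc (suc (k + k)) + j
    ℓ+h≡2k+2+j = ℓ+[ℓ+j]≡[2ℓ]+j k j
      where
      ℓ+[ℓ+j]≡[2ℓ]+j : ∀ k j → suc k + (suc k + j) ≡ suc (suc (k + k)) + j
      ℓ+[ℓ+j]≡[2ℓ]+j = solve-∀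
  ... | no h≰m∸ℓ = trans (cong (binom α j *_) (P-vanishes k (m ∸ j) m∸j<2k+2)) (trans (*-zeroʳ (binom α j))
                         (sym (restrict-above (suc k) _ (≤-<-trans (m⊓n≤m (m ∸ suc k) (suc k + α)) (≰⇒> h≰m∸ℓ)))))
    where
    ℓ+[ℓ+j]≡j+[2ℓ] : ∀ k j → suc k + (suc k + j) ≡ j + suc (suc (k + k))
    ℓ+[ℓ+j]≡j+[2ℓ] = solve-∀
    m∸j<2k+2 : m ∸ j < suc (suc (k + k))
    m∸j<2k+2 = m<n+o⇒m∸n<o m j (≤-trans (m∸n<o⇒m<n+o m (suc k) (≰⇒> h≰m∸ℓ)) (≤-reflexive (ℓ+[ℓ+j]≡j+[2ℓ] k j)))

  restrict-R-term : ∀ k α m h →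
    restrict (suc k) (suc k + α) h (binom α (h ∸ suc k) * P (m ∸ (h ∸ suc k)) k)
    ≡ restrict (suc k) ((m ∸ suc k) ⊓ (suc k + α)) h (binom (m ∸ h ∸ 1) k * binom α (h ∸ suc k))
  restrict-R-term k α m h with suc k ≤? h
  ... | no ℓ≰h = trans (restrict-below (suc k) _ (≰⇒> ℓ≰h)) (sym (restrict-below (suc k) _ (≰⇒> ℓ≰h)))
  ... | yes ℓ≤h with m≤n⇒∃[o]m+o≡n ℓ≤h
  ... | j , refl with j ≤? α
  ...   | no j≰α = trans (restrict-above (suc k) _ (+-monoʳ-< (suc k) (≰⇒> j≰α)))
                         (sym (restrict-above (suc k) _ (≤-<-trans (m⊓n≤n (m ∸ suc k) (suc k + α)) (+-monoʳ-< (suc k) (≰⇒> j≰α)))))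
  ...   | yes j≤α = begin
    restrict ℓ (ℓ + α) h (binom α (h ∸ ℓ) * P (m ∸ (h ∸ ℓ)) k)  ≡⟨ restrict-in ℓ _ ℓ≤h (+-monoʳ-≤ ℓ j≤α) ⟩
    binom α (h ∸ ℓ) * P (m ∸ (h ∸ ℓ)) k                      ≡⟨ cong (λ i → binom α i * P (m ∸ i) k) h∸ℓ≡j ⟩
    binom α j * P (m ∸ j) k                                  ≡⟨ binom*P-∸ k α m j j≤α ⟩
    restrict ℓ b h (binom (m ∸ h ∸ 1) k * binom α j)         ≡⟨ cong (λ i → restrict ℓ b h (binom (m ∸ h ∸ 1) k * binom α i)) h∸ℓ≡j ⟨
    restrict ℓ b h (binom (m ∸ h ∸ 1) k * binom α (h ∸ ℓ))   ∎
    where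
    ℓ = suc k
    b = (m ∸ suc k) ⊓ (suc k + α)
    h∸ℓ≡j : h ∸ ℓ ≡ j
    h∸ℓ≡j = m+n∸m≡n ℓ j

  R-closed-form : ∀ k α m → R α m (suc k) ≡ ∑Range (suc k) ((m ∸ suc k) ⊓ (suc k + α)) (λ h → binom (m ∸ h ∸ 1) k * binom α (h ∸ suc k))
  R-closed-form k α m = begin
    R α m ℓ                                         ≡⟨ R-suc-as-∑ α m k ⟩
    ∑ (suc α) (λ j → binom α j * P (m ∸ j) k)       ≡⟨ cong (λ n → ∑ n (λ j → binom α j * P (m ∸ j) k)) (sym (trans (cong (_∸ ℓ) (sym (+-suc ℓ α))) (m+n∸m≡n ℓ (suc α)))) ⟩
    ∑ (suc (ℓ + α) ∸ ℓ) (λ j → binom α j * P (m ∸ j) k)  ≡⟨ ∑-cong (suc (ℓ + α) ∸ ℓ) (λ i → cong (λ j → binom α j * P (m ∸ j) k) (sym (m+n∸m≡n ℓ i))) ⟩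
    ∑Range ℓ (ℓ + α) f                              ≡⟨ ∑Range-as-∑ ℓ (ℓ + α) (suc (ℓ + α)) f (n<1+n (ℓ + α)) ⟩
    ∑ (suc (ℓ + α)) (λ h → restrict ℓ (ℓ + α) h (f h)) ≡⟨ ∑-cong (suc (ℓ + α)) (restrict-R-term k α m) ⟩
    ∑ (suc (ℓ + α)) (λ h → restrict ℓ b h (g h))    ≡⟨ ∑Range-as-∑ ℓ b (suc (ℓ + α)) g (s≤s (m⊓n≤n (m ∸ ℓ) (ℓ + α))) ⟨
    ∑Range ℓ b g                                    ∎
    where
    ℓ = suc k
    b = (m ∸ ℓ) ⊓ (ℓ + α)
    f g : ℕ → ℕ
    f h = binom α (h ∸ ℓ) * P (m ∸ (h ∸ ℓ)) k
    g h = binom (m ∸ h ∸ 1) k * binom α (h ∸ ℓ)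

  secondSum : ℕ → ℕ → ℕ → ℕ
  secondSum m n k = ∑Range (suc k) ((m ∸ suc k) ⊓ n) (λ h → binom (m ∸ h ∸ 1) k * binom (n ∸ suc k) (h ∸ suc k))

  Y-closed-form : ∀ m n k → Y m n (suc k) ≡ binom (suc n) (suc k) * secondSum m (suc n) k
  Y-closed-form m n k with suc k ≤? suc n
  ... | no ℓ≰n = trans (cong (_* R (suc n ∸ suc k) m (suc k)) vanishes) (sym (cong (_* secondSum m (suc n) k) vanishes))
    where
    vanishes : binom (suc n) (suc k) ≡ 0
    vanishes = binom-< (≰⇒> ℓ≰n)
  ... | yes ℓ≤n with m≤n⇒∃[o]m+o≡n ℓ≤n
  ... | α , ℓ+α≡n = cong (binom (suc n) (suc k) *_) (begin
    R (suc n ∸ suc k) m (suc k)       ≡⟨ cong (λ x → R (x ∸ suc k) m (suc k)) ℓ+α≡n ⟨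
    R (suc k + α ∸ suc k) m (suc k)   ≡⟨ cong (λ x → R x m (suc k)) (m+n∸m≡n (suc k) α) ⟩
    R α m (suc k)                     ≡⟨ R-closed-form k α m ⟩
    ∑Range (suc k) ((m ∸ suc k) ⊓ (suc k + α)) (λ h → binom (m ∸ h ∸ 1) k * binom α (h ∸ suc k))
      ≡⟨ cong₂ (λ x y → ∑Range (suc k) ((m ∸ suc k) ⊓ x) (λ h → binom (m ∸ h ∸ 1) k * binom y (h ∸ suc k)))
               ℓ+α≡n (trans (sym (m+n∸m≡n (suc k) α)) (cong (_∸ suc k) ℓ+α≡n)) ⟩
    secondSum m (suc n) k            ∎)

  cBelow : ℕ → ℕ → ℕ → ℕ
  cBelow zero    h d = 0
  cBelow (suc k) h d = binom h (suc k) * binom d k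

  cBelow-absorb : ∀ ℓ h d → cBelow ℓ h d * suc d ≡ ℓ * (binom h ℓ * binom (suc d) ℓ)
  cBelow-absorb zero    h d = refl
  cBelow-absorb (suc k) h d = begin
    binom h (suc k) * binom d k * suc d             ≡⟨ *-assoc (binom h (suc k)) (binom d k) (suc d) ⟩
    binom h (suc k) * (binom d k * suc d)           ≡⟨ cong (binom h (suc k) *_) (trans (*-comm (binom d k) (suc d)) (sym (binom-absorb d k))) ⟩
    binom h (suc k) * (suc k * binom (suc d) (suc k)) ≡⟨ *-CS.x∙yz≈y∙xz (binom h (suc k)) (suc k) _ ⟩
    suc k * (binom h (suc k) * binom (suc d) (suc k)) ∎

  -- cTerm m n ℓ h is c m h ℓ * binom n h, using ℓ / (d + 1) * binom (d + 1) ℓ = binom d (ℓ ∸ 1).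
  cTerm : ℕ → ℕ → ℕ → ℕ → ℕ
  cTerm m n ℓ h = if h <ᵇ m then cBelow ℓ h (m ∸ h ∸ 1) * binom n h
                  else (if h ≡ᵇ m then (if ℓ ≡ᵇ 0 then binom n h else 0) else 0)

  cTerm-< : ∀ {m n ℓ h} → h < m → cTerm m n ℓ h ≡ cBelow ℓ h (m ∸ h ∸ 1) * binom n h
  cTerm-< {m} {n} {ℓ} {h} h<m with h <ᵇ m | <ᵇ-reflects-< h m
  ... | true  | _         = refl
  ... | false | ofⁿ h≮m  = contradiction h<m h≮m

  cTerm-≡0 : ∀ m n k h → (h < m → cBelow (suc k) h (m ∸ h ∸ 1) * binom n h ≡ 0) → cTerm m n (suc k) h ≡ 0
  cTerm-≡0 m n k h vanishes with h <ᵇ m | <ᵇ-reflects-< h m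
  ... | true  | ofʸ h<m = vanishes h<m
  ... | false | _ with h ≡ᵇ m
  ...   | true  = refl
  ...   | false = refl

  cTerm-diag : ∀ m n → cTerm m n 0 m ≡ binom n m
  cTerm-diag m n with m <ᵇ m | <ᵇ-reflects-< m m
  ... | true  | ofʸ m<m = contradiction m<m (<-irrefl refl)
  ... | false | _ rewrite Equivalence.to T-≡ (≡⇒≡ᵇ m m refl) = refl

  ∑cTerm-zero : ∀ m n → 1 ≤ m → ∑ (m ⊓ n) (λ i → cTerm m n 0 (suc i)) ≡ binom n m
  ∑cTerm-zero (suc m) n _ with suc m ≤? n
  ... | yes 1+m≤n = begin
    ∑ (suc m ⊓ n) f          ≡⟨ cong (λ k → ∑ k f) (m≤n⇒m⊓n≡m 1+m≤n) ⟩
    ∑ (suc m) f              ≡⟨ ∑-suc m f ⟩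
    ∑ m f + f m              ≡⟨ cong₂ _+_ (∑-zero m f (λ i i<m → cTerm-< {n = n} {ℓ = 0} (s≤s i<m))) (cTerm-diag (suc m) n) ⟩
    binom n (suc m)          ∎
    where
    f : ℕ → ℕ
    f i = cTerm (suc m) n 0 (suc i)
  ... | no m≮n = begin
    ∑ (suc m ⊓ n) f          ≡⟨ cong (λ k → ∑ k f) (m≥n⇒m⊓n≡n (<⇒≤ (≰⇒> m≮n))) ⟩
    ∑ n f                    ≡⟨ ∑-zero n f (λ i i<n → cTerm-< {n = n} {ℓ = 0} (<-≤-trans (s≤s i<n) (≰⇒> m≮n))) ⟩
    0                        ≡⟨ binom-< (≰⇒> m≮n) ⟨
    binom n (suc m)          ∎
    where
    f : ℕ → ℕ
    f i = cTerm (suc m) n 0 (suc i)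

  in-range⇒< : ∀ m n k h → suc k ≤ h → h ≤ (m ∸ suc k) ⊓ n → h < m
  in-range⇒< m n k h ℓ≤h h≤b = <-≤-trans (m<m+n h z<s) (m≤o∸n⇒m+n≤o′ (≤-trans z<s ℓ≤h) (≤-trans h≤b (m⊓n≤m _ n)))

  cTerm-below : ∀ m n k h → h < suc k → cTerm m n (suc k) h ≡ 0
  cTerm-below m n k h h<ℓ = cTerm-≡0 m n k h (λ _ → cong (λ x → x * binom (m ∸ h ∸ 1) k * binom n h) (binom-< h<ℓ))

  cTerm-above : ∀ m n k h → (m ∸ suc k) ⊓ n < h → cTerm m n (suc k) h ≡ 0
  cTerm-above m n k h b<h = cTerm-≡0 m n k h vanishes
    where
    vanishes : h < m → binom h (suc k) * binom (m ∸ h ∸ 1) k * binom n h ≡ 0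
    vanishes h<m with h ≤? n
    ... | no h≰n = trans (cong (binom h (suc k) * binom (m ∸ h ∸ 1) k *_) (binom-< (≰⇒> h≰n))) (*-zeroʳ (binom h (suc k) * binom (m ∸ h ∸ 1) k))
    ... | yes h≤n with h ≤? m ∸ suc k
    ...   | yes h≤m∸ℓ = contradiction (⊓-glb h≤m∸ℓ h≤n) (<⇒≱ b<h)
    ...   | no h≰m∸ℓ = trans (cong (λ x → binom h (suc k) * x * binom n h) (binom-< (∸-monoˡ-< m∸h<ℓ (m<n⇒0<n∸m h<m))))
                              (cong (_* binom n h) (*-zeroʳ (binom h (suc k))))
      where
      m∸h<ℓ : m ∸ h < suc k
      m∸h<ℓ = m<n+o⇒m∸n<o m h (subst (m <_) (+-comm (suc k) h) (m∸n<o⇒m<n+o m (suc k) (≰⇒> h≰m∸ℓ)))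

  cTerm-in-range : ∀ m n k h → suc k ≤ h → h ≤ (m ∸ suc k) ⊓ n →
                   cTerm m n (suc k) h ≡ binom n (suc k) * (binom (m ∸ h ∸ 1) k * binom (n ∸ suc k) (h ∸ suc k))
  cTerm-in-range m n k h ℓ≤h h≤b = begin
    cTerm m n ℓ h                                 ≡⟨ cTerm-< {n = n} {ℓ = ℓ} (in-range⇒< m n k h ℓ≤h h≤b) ⟩
    binom h ℓ * Cₘₕ * binom n h                   ≡⟨ *-CS.xy∙z≈y∙zx (binom h ℓ) Cₘₕ (binom n h) ⟩
    Cₘₕ * (binom n h * binom h ℓ)                 ≡⟨ cong (Cₘₕ *_) (binom-subset n h ℓ ℓ≤h) ⟩
    Cₘₕ * (binom n ℓ * binom (n ∸ ℓ) (h ∸ ℓ))     ≡⟨ *-CS.x∙yz≈y∙xz Cₘₕ (binom n ℓ) _ ⟩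
    binom n ℓ * (Cₘₕ * binom (n ∸ ℓ) (h ∸ ℓ))     ∎
    where
    ℓ = suc k
    Cₘₕ = binom (m ∸ h ∸ 1) k

  restrict-cTerm : ∀ m n k h →
    restrict 1 (m ⊓ n) h (cTerm m n (suc k) h)
    ≡ binom n (suc k) * restrict (suc k) ((m ∸ suc k) ⊓ n) h (binom (m ∸ h ∸ 1) k * binom (n ∸ suc k) (h ∸ suc k))
  restrict-cTerm m n k h with suc k ≤? h | h ≤? (m ∸ suc k) ⊓ n
  ... | yes ℓ≤h | yes h≤b = begin
    restrict 1 (m ⊓ n) h (cTerm m n ℓ h)        ≡⟨ restrict-in 1 (m ⊓ n) (≤-trans (s≤s z≤n) ℓ≤h)
                                                                 (⊓-glb (<⇒≤ (in-range⇒< m n k h ℓ≤h h≤b)) (≤-trans h≤b (m⊓n≤n _ n))) ⟩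
    cTerm m n ℓ h                               ≡⟨ cTerm-in-range m n k h ℓ≤h h≤b ⟩
    binom n ℓ * g                               ≡⟨ cong (binom n ℓ *_) (restrict-in ℓ ((m ∸ ℓ) ⊓ n) ℓ≤h h≤b) ⟨
    binom n ℓ * restrict ℓ ((m ∸ ℓ) ⊓ n) h g    ∎
    where
    ℓ = suc k
    g = binom (m ∸ h ∸ 1) k * binom (n ∸ ℓ) (h ∸ ℓ)
  ... | no ℓ≰h  | _      = trans (restrict-≡0 1 (m ⊓ n) h (cTerm-below m n k h (≰⇒> ℓ≰h)))
                                 (sym (trans (cong (binom n (suc k) *_) (restrict-below (suc k) _ (≰⇒> ℓ≰h))) (*-zeroʳ (binom n (suc k)))))
  ... | yes _   | no h≰b = trans (restrict-≡0 1 (m ⊓ n) h (cTerm-above m n k h (≰⇒> h≰b)))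
                                 (sym (trans (cong (binom n (suc k) *_) (restrict-above (suc k) _ (≰⇒> h≰b))) (*-zeroʳ (binom n (suc k)))))

  ∑cTerm-suc : ∀ m n k → ∑ (m ⊓ n) (λ i → cTerm m n (suc k) (suc i)) ≡ binom n (suc k) * secondSum m n k
  ∑cTerm-suc m n k = begin
    ∑ (m ⊓ n) (λ i → cTerm m n ℓ (suc i))          ≡⟨ ∑Range-as-∑ 1 (m ⊓ n) M (cTerm m n ℓ) (s≤s (m⊓n≤m+n m n)) ⟩
    ∑ M (λ h → restrict 1 (m ⊓ n) h (cTerm m n ℓ h)) ≡⟨ ∑-cong M (restrict-cTerm m n k) ⟩
    ∑ M (λ h → binom n ℓ * restrict ℓ b h (g h))   ≡⟨ *-distribˡ-∑ M (binom n ℓ) (λ h → restrict ℓ b h (g h)) ⟨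
    binom n ℓ * ∑ M (λ h → restrict ℓ b h (g h))   ≡⟨ cong (binom n ℓ *_) (∑Range-as-∑ ℓ b M g (s≤s (≤-trans (m⊓n≤n (m ∸ ℓ) n) (m≤n+m n m)))) ⟨
    binom n ℓ * secondSum m n k                   ∎
    where
    ℓ = suc k
    M = suc (m + n)
    b = (m ∸ ℓ) ⊓ n
    g : ℕ → ℕ
    g h = binom (m ∸ h ∸ 1) k * binom (n ∸ ℓ) (h ∸ ℓ)

  ∑cTerm≡Y : ∀ m n ℓ → 1 ≤ m → ∑ (m ⊓ suc n) (λ i → cTerm m (suc n) ℓ (suc i)) ≡ Y m n ℓ
  ∑cTerm≡Y m n zero    1≤m = trans (∑cTerm-zero m (suc n) 1≤m) (sym (trans (+-identityʳ _) (R-0 (suc n) m)))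
  ∑cTerm≡Y m n (suc k) _   = trans (∑cTerm-suc m (suc n) k) (sym (Y-closed-form m n k))

  T*n≡N*Y : ∀ m n ℓ → 4 ≤ m + suc n → T m (suc n) ℓ w001 * suc n ≡ (m + suc n) * Y m n ℓ
  T*n≡N*Y m n ℓ 4≤N = begin
    T m (suc n) ℓ w001 * suc n                                          ≡⟨ cong (_* suc n) (T≡sumOver-counted m (suc n) ℓ) ⟩
    sumOver (counted m (suc n) ℓ) (allWords (m + suc n)) * suc n      ≡⟨ cong (λ k → sumOver (counted m (suc n) ℓ) (allWords k) * suc n) (+-suc m n) ⟩
    sumOver (counted m (suc n) ℓ) (allWords (suc K)) * suc n            ≡⟨ sumOver-counted-*-n m (suc n) ℓ K (≤-trans 4≤N (≤-reflexive (+-suc m n))) ⟩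
    suc K * sumOver (λ v → counted m (suc n) ℓ (true ∷ v)) (allWords K) ≡⟨ cong (suc K *_) (sumOver-cong (allWords K) (counted-true∷ m n ℓ)) ⟩
    suc K * sumOver (matching run0 m n ℓ) (allWords K)                  ≡⟨ cong (suc K *_) (sumOver-matching K run0 m n ℓ refl) ⟩
    suc K * runCount run0 m n ℓ                                         ≡⟨ cong₂ _*_ (sym (+-suc m n)) (runCount≡Y m n ℓ) ⟩
    (m + suc n) * Y m n ℓ                                             ∎
    where
    K = m + n


open import Defs
open import Data.Nat using (ℕ; _≤_; _⊓_; _∸_)
open import Data.Product using (_×_)
open import Relation.Binary.PropositionalEquality using (_≡_)
open import Data.Rational using (ℚ; _*_)
open import Data.Nat.Combinatorics using (_C_)

open import Data.Nat using (zero; suc; s≤s; z≤n)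
import Data.Nat as ℕ
import Data.Nat.Properties as ℕ
open import Data.Bool using (true; false)
open import Data.Integer using (+_)
import Data.Integer as ℤ
import Data.Integer.Properties as ℤ
import Data.Rational as ℚ
import Data.Rational.Properties as ℚ
open import Data.Rational.Unnormalised as ℚᵘ using (mkℚᵘ; *≡*)
import Data.Rational.Unnormalised.Properties as ℚᵘ
open import Data.List using (map; applyUpTo; foldr)
open import Data.Product using (_,_)
open import Function using (_∘_)
open import Relation.Nullary.Reflects using (ofʸ)
open import Relation.Binary.PropositionalEquality using (refl; sym; trans; cong; cong₂; module ≡-Reasoning)
open ≡-Reasoning
open Counting

fromℚᵘ-homo-+ : ∀ p q → ℚ.fromℚᵘ (p ℚᵘ.+ q) ≡ ℚ.fromℚᵘ p ℚ.+ ℚ.fromℚᵘ q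
fromℚᵘ-homo-+ p q = ℚ.toℚᵘ-injective (ℚᵘ.≃-trans (ℚ.toℚᵘ-fromℚᵘ (p ℚᵘ.+ q))
  (ℚᵘ.≃-sym (ℚᵘ.≃-trans (ℚ.toℚᵘ-homo-+ (ℚ.fromℚᵘ p) (ℚ.fromℚᵘ q)) (ℚᵘ.+-cong (ℚ.toℚᵘ-fromℚᵘ p) (ℚ.toℚᵘ-fromℚᵘ q)))))

fromℚᵘ-homo-* : ∀ p q → ℚ.fromℚᵘ (p ℚᵘ.* q) ≡ ℚ.fromℚᵘ p ℚ.* ℚ.fromℚᵘ q
fromℚᵘ-homo-* p q = ℚ.toℚᵘ-injective (ℚᵘ.≃-trans (ℚ.toℚᵘ-fromℚᵘ (p ℚᵘ.* q))
  (ℚᵘ.≃-sym (ℚᵘ.≃-trans (ℚ.toℚᵘ-homo-* (ℚ.fromℚᵘ p) (ℚ.fromℚᵘ q)) (ℚᵘ.*-cong (ℚ.toℚᵘ-fromℚᵘ p) (ℚ.toℚᵘ-fromℚᵘ q)))))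

-- ℕ→ℚ k is definitionally ℚ.fromℚᵘ (mkℚᵘ (+ k) 0).
ℕ→ℚ-homo-+ : ∀ a b → ℕ→ℚ (a ℕ.+ b) ≡ ℕ→ℚ a ℚ.+ ℕ→ℚ b
ℕ→ℚ-homo-+ a b = trans (ℚ.fromℚᵘ-cong {mkℚᵘ (+ (a ℕ.+ b)) 0} {mkℚᵘ (+ a) 0 ℚᵘ.+ mkℚᵘ (+ b) 0} (*≡* (cong (ℤ._* + 1) (begin
  + (a ℕ.+ b)                  ≡⟨ ℤ.pos-+ a b ⟩
  + a ℤ.+ + b                  ≡⟨ cong₂ ℤ._+_ (ℤ.*-identityʳ (+ a)) (ℤ.*-identityʳ (+ b)) ⟨
  + a ℤ.* + 1 ℤ.+ + b ℤ.* + 1  ∎))))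
  (fromℚᵘ-homo-+ (mkℚᵘ (+ a) 0) (mkℚᵘ (+ b) 0))

ℕ→ℚ-homo-* : ∀ a b → ℕ→ℚ (a ℕ.* b) ≡ ℕ→ℚ a ℚ.* ℕ→ℚ b
ℕ→ℚ-homo-* a b = trans (ℚ.fromℚᵘ-cong {mkℚᵘ (+ (a ℕ.* b)) 0} {mkℚᵘ (+ a) 0 ℚᵘ.* mkℚᵘ (+ b) 0} (*≡* (cong (ℤ._* + 1) (ℤ.pos-* a b)))) (fromℚᵘ-homo-* (mkℚᵘ (+ a) 0) (mkℚᵘ (+ b) 0))

ℕ→ℚ-frac : ∀ t a x d → t ℕ.* suc d ≡ a ℕ.* x → ℕ→ℚ t ≡ frac a (suc d) ℚ.* ℕ→ℚ x
ℕ→ℚ-frac t a x d t*[1+d]≡a*x = trans (ℚ.fromℚᵘ-cong {mkℚᵘ (+ t) 0} {mkℚᵘ (+ a) d ℚᵘ.* mkℚᵘ (+ x) 0} (*≡* (begin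
  + t ℤ.* + (suc d ℕ.* 1)      ≡⟨ cong (λ k → + t ℤ.* + k) (ℕ.*-identityʳ (suc d)) ⟩
  + t ℤ.* + suc d              ≡⟨ ℤ.pos-* t (suc d) ⟨
  + (t ℕ.* suc d)              ≡⟨ cong +_ t*[1+d]≡a*x ⟩
  + (a ℕ.* x)                  ≡⟨ ℤ.pos-* a x ⟩
  + a ℤ.* + x                  ≡⟨ ℤ.*-identityʳ _ ⟨
  (+ a ℤ.* + x) ℤ.* + 1        ∎)))
  (fromℚᵘ-homo-* (mkℚᵘ (+ a) d) (mkℚᵘ (+ x) 0))

foldr-map-applyUpTo : ∀ n (F : ℕ → ℚ) (f g : ℕ → ℕ) → (∀ i → F i ≡ ℕ→ℚ (f i)) →
                      foldr ℚ._+_ ℚ.0ℚ (map F (applyUpTo g n)) ≡ ℕ→ℚ (∑ n (f ∘ g))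
foldr-map-applyUpTo zero    F f g F≡f = refl
foldr-map-applyUpTo (suc n) F f g F≡f =
  trans (cong₂ ℚ._+_ (F≡f (g 0)) (foldr-map-applyUpTo n F f (g ∘ suc) F≡f)) (sym (ℕ→ℚ-homo-+ (f (g 0)) _))

sumFromTo-ℕ→ℚ : ∀ a b (F : ℕ → ℚ) (f : ℕ → ℕ) → (∀ h → F h ≡ ℕ→ℚ (f h)) → sumFromTo a b F ≡ ℕ→ℚ (∑Range a b f)
sumFromTo-ℕ→ℚ a b F f F≡f = foldr-map-applyUpTo (suc b ℕ.∸ a) (λ i → F (a ℕ.+ i)) (λ i → f (a ℕ.+ i)) (λ i → i) (λ i → F≡f (a ℕ.+ i))

c-≡-cTerm : ∀ m n h ℓ → c m h ℓ ℚ.* ℕ→ℚ (n C h) ≡ ℕ→ℚ (cTerm m n ℓ h)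
c-≡-cTerm m n h ℓ with h ℕ.<ᵇ m | ℕ.<ᵇ-reflects-< h m
... | true  | ofʸ h<m = below (m ℕ.∸ h) (ℕ.m<n⇒0<n∸m h<m)
  where
  below : ∀ x → 0 ℕ.< x → frac ℓ x ℚ.* ℕ→ℚ ((h C ℓ) ℕ.* (x C ℓ)) ℚ.* ℕ→ℚ (n C h) ≡ ℕ→ℚ (cBelow ℓ h (x ℕ.∸ 1) ℕ.* binom n h)
  below (suc d) _ = begin
    frac ℓ (suc d) ℚ.* ℕ→ℚ ((h C ℓ) ℕ.* (suc d C ℓ)) ℚ.* ℕ→ℚ (n C h)
      ≡⟨ cong₂ (λ x y → frac ℓ (suc d) ℚ.* ℕ→ℚ x ℚ.* ℕ→ℚ y) (cong₂ ℕ._*_ (C≡binom h ℓ) (C≡binom (suc d) ℓ)) (C≡binom n h) ⟩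
    frac ℓ (suc d) ℚ.* ℕ→ℚ (binom h ℓ ℕ.* binom (suc d) ℓ) ℚ.* ℕ→ℚ (binom n h)
      ≡⟨ cong (ℚ._* ℕ→ℚ (binom n h)) (ℕ→ℚ-frac (cBelow ℓ h d) ℓ _ d (cBelow-absorb ℓ h d)) ⟨
    ℕ→ℚ (cBelow ℓ h d) ℚ.* ℕ→ℚ (binom n h)
      ≡⟨ ℕ→ℚ-homo-* (cBelow ℓ h d) (binom n h) ⟨
    ℕ→ℚ (cBelow ℓ h d ℕ.* binom n h) ∎
... | false | _ with h ℕ.≡ᵇ m
...   | false = ℚ.*-zeroˡ (ℕ→ℚ (n C h))
...   | true with ℓ ℕ.≡ᵇ 0
...     | true  = trans (ℚ.*-identityˡ (ℕ→ℚ (n C h))) (cong ℕ→ℚ (C≡binom n h))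
...     | false = ℚ.*-zeroˡ (ℕ→ℚ (n C h))

first-formula≡Y : ∀ m n ℓ → 1 ≤ m → sumFromTo 1 (m ⊓ suc n) (λ h → c m h ℓ * ℕ→ℚ (suc n C h)) ≡ ℕ→ℚ (Y m n ℓ)
first-formula≡Y m n ℓ 1≤m = trans (sumFromTo-ℕ→ℚ 1 (m ⊓ suc n) _ (cTerm m (suc n) ℓ) (λ h → c-≡-cTerm m (suc n) h ℓ))
                              (cong ℕ→ℚ (∑cTerm≡Y m n ℓ 1≤m))

second-formula≡Y : ∀ m n k → ℕ→ℚ (suc n C suc k) * sumFromTo (suc k) ((m ∸ suc k) ⊓ suc n)
                           (λ h → ℕ→ℚ (((m ∸ h ∸ 1) C k) ℕ.* ((suc n ∸ suc k) C (h ∸ suc k))))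
                         ≡ ℕ→ℚ (Y m n (suc k))
second-formula≡Y m n k = begin
  ℕ→ℚ (suc n C suc k) * sumFromTo (suc k) ((m ∸ suc k) ⊓ suc n) F
    ≡⟨ cong₂ ℚ._*_ (cong ℕ→ℚ (C≡binom (suc n) (suc k))) (sumFromTo-ℕ→ℚ (suc k) ((m ∸ suc k) ⊓ suc n) F f F≡f) ⟩
  ℕ→ℚ (binom (suc n) (suc k)) * ℕ→ℚ (secondSum m (suc n) k)
    ≡⟨ ℕ→ℚ-homo-* (binom (suc n) (suc k)) (secondSum m (suc n) k) ⟨
  ℕ→ℚ (binom (suc n) (suc k) ℕ.* secondSum m (suc n) k)
    ≡⟨ cong ℕ→ℚ (Y-closed-form m n k) ⟨
  ℕ→ℚ (Y m n (suc k)) ∎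
  where
  F : ℕ → ℚ
  F h = ℕ→ℚ (((m ∸ h ∸ 1) C k) ℕ.* ((suc n ∸ suc k) C (h ∸ suc k)))
  f : ℕ → ℕ
  f h = binom (m ∸ h ∸ 1) k ℕ.* binom (suc n ∸ suc k) (h ∸ suc k)
  F≡f : ∀ h → F h ≡ ℕ→ℚ (f h)
  F≡f h = cong ℕ→ℚ (cong₂ ℕ._*_ (C≡binom (m ∸ h ∸ 1) k) (C≡binom (suc n ∸ suc k) (h ∸ suc k)))

mainTheorem8 : (m n ℓ : ℕ) → 1 ≤ m → 1 ≤ n → 4 ≤ m Data.Nat.+ n →
    (ℕ→ℚ (T m n ℓ w001) ≡ frac (m Data.Nat.+ n) n * sumFromTo 1 (m ⊓ n) (λ h → c m h ℓ * ℕ→ℚ (n C h)))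
    × (1 ≤ ℓ → ℕ→ℚ (T m n ℓ w001) ≡ frac (m Data.Nat.+ n) n * ℕ→ℚ (n C ℓ) * sumFromTo ℓ ((m ∸ ℓ) ⊓ n) (λ h → ℕ→ℚ (((m ∸ h ∸ 1) C (ℓ ∸ 1)) Data.Nat.* ((n ∸ ℓ) C (h ∸ ℓ)))))
mainTheorem8 m (suc n) ℓ 1≤m _ 4≤N = first , second
  where
  N/n : ℚ
  N/n = frac (m ℕ.+ suc n) (suc n)
  T≡N/n*Y : ∀ ℓ → ℕ→ℚ (T m (suc n) ℓ w001) ≡ N/n * ℕ→ℚ (Y m n ℓ)
  T≡N/n*Y ℓ = ℕ→ℚ-frac (T m (suc n) ℓ w001) (m ℕ.+ suc n) (Y m n ℓ) n (T*n≡N*Y m n ℓ 4≤N)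
  first : ℕ→ℚ (T m (suc n) ℓ w001) ≡ N/n * sumFromTo 1 (m ⊓ suc n) (λ h → c m h ℓ * ℕ→ℚ (suc n C h))
  first = trans (T≡N/n*Y ℓ) (cong (N/n *_) (sym (first-formula≡Y m n ℓ 1≤m)))
  second : 1 ≤ ℓ → ℕ→ℚ (T m (suc n) ℓ w001) ≡ N/n * ℕ→ℚ (suc n C ℓ) * sumFromTo ℓ ((m ∸ ℓ) ⊓ suc n)
                       (λ h → ℕ→ℚ (((m ∸ h ∸ 1) C (ℓ ∸ 1)) ℕ.* ((suc n ∸ ℓ) C (h ∸ ℓ))))
  second (s≤s {n = k} z≤n) =
    trans (T≡N/n*Y (suc k)) (trans (cong (N/n *_) (sym (second-formula≡Y m n k))) (sym (ℚ.*-assoc N/n _ _)))
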